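{- Let $k\ge3$ and let $G$ be a linear $k$-partite $k$-graph of girth at least $5$. Then for every partition class $Z$ of $G$ and every edge $vu\in E(Z_2)$, we have $|N_G(\{v\})\cap N_G(\{u\})|=1$.
   Context: A $k$-graph is a hypergraph each of whose edges has exactly $k$ vertices; it is $k$-partite if its vertex set can be partitioned into $k$ partition classes such that each edge contains exactly one vertex of each class; it is linear if any two distinct edges share at most one vertex. For $S\subseteq V(G)$, $N_G(S):=\big(\bigcup_{e\in E(G),\,e\cap S\ne\emptyset}e\big)\setminus S$. For a partition class $Z$, $Z_2$ is the graph on vertex set $Z$ in which distinct $v,u$ are adjacent iff $N_G(\{v\})\cap N_G(\{u\})\ne\emptyset$. For $\ell\ge3$, a loose $\ell$-cycle in a $k$-graph is a sequence of $(k-1)\ell$ distinct vertices $v_1,\dots,v_{(k-1)\ell}$ such that $\{v_{(k-1)(i-1)+1},\dots,v_{(k-1)i+1}\}\in E(G)$ for each $i\in\{1,\dots,\ell\}$, indices taken modulo $(k-1)\ell$. The girth of $G$ is the minimum $\ell$ such that $G$ contains a loose $\ell$-cycle ($\infty$ if there is none). -}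

module Defs where

open import Data.Nat using (ℕ; zero; suc; _+_; _*_; _∸_; _≤_; _<_)
open import Data.Fin using (Fin; toℕ)
open import Data.Fin.Subset using (Subset; _∈_; ∣_∣; _∩_)
open import Data.Product using (Σ; _×_; ∃; ∃-syntax; _,_)
open import Relation.Binary.PropositionalEquality using (_≡_; _≢_)
open import Relation.Nullary using (¬_)
open import Function.Definitions using (Injective)

record Hypergraph : Set₁ where
  field
    n : ℕ
    E : Subset n → Set
open Hypergraph public

IsKGraph : ℕ → Hypergraph → Set
IsKGraph k G = ∀ e → E G e → ∣ e ∣ ≡ k

IsKPartition : (k : ℕ) (G : Hypergraph) → (Fin (n G) → Fin k) → Set
IsKPartition k G part =
  ∀ e → E G e → ∀ (i : Fin k) →
    Σ (Fin (n G)) λ x → (x ∈ e × part x ≡ i) × (∀ y → y ∈ e → part y ≡ i → y ≡ x)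

IsLinear : Hypergraph → Set
IsLinear G = ∀ e f → E G e → E G f → e ≢ f → ∣ e ∩ f ∣ ≤ 1

_≡ₘ_ : ∀ {m} → Fin m → ℕ → Set
_≡ₘ_ {m} p a = ∃[ q ] a ≡ toℕ p + q * m

-- A loose ℓ-cycle in a k-graph: distinct vertices v_0,…,v_{(k-1)ℓ-1}
-- (0-indexed) such that for every i < ℓ the set
-- {v_{(k-1)i + j mod (k-1)ℓ} : j < k} is an edge.
LooseCycle : (k ℓ : ℕ) (G : Hypergraph) → Set
LooseCycle k ℓ G =
  Σ (Fin ((k ∸ 1) * ℓ) → Fin (n G)) λ v →
    Injective _≡_ _≡_ v ×
    (∀ (i : Fin ℓ) → Σ (Subset (n G)) λ e → E G e ×
       (∀ x → (x ∈ e → Σ (Fin k) λ j → Σ (Fin ((k ∸ 1) * ℓ)) λ p →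
                          p ≡ₘ ((k ∸ 1) * toℕ i + toℕ j) × v p ≡ x)
            × ((Σ (Fin k) λ j → Σ (Fin ((k ∸ 1) * ℓ)) λ p →
                          p ≡ₘ ((k ∸ 1) * toℕ i + toℕ j) × v p ≡ x) → x ∈ e)))

GirthAtLeast : (k g : ℕ) → Hypergraph → Set
GirthAtLeast k g G = ∀ ℓ → 3 ≤ ℓ → ℓ < g → ¬ LooseCycle k ℓ G

InNbhd : (G : Hypergraph) → Fin (n G) → Fin (n G) → Set
InNbhd G v w = w ≢ v × Σ (Subset (n G)) λ e → E G e × v ∈ e × w ∈ e

Z₂Edge : (G : Hypergraph) {k : ℕ} → (Fin (n G) → Fin k) → Fin k →
         Fin (n G) → Fin (n G) → Set
Z₂Edge G part c v u =
  part v ≡ c × part u ≡ c × v ≢ u × ∃[ w ] (InNbhd G v w × InNbhd G u w)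

CommonNbhdSizeOne : (G : Hypergraph) → Fin (n G) → Fin (n G) → Set
CommonNbhdSizeOne G v u =
  Σ (Fin (n G)) λ w → (InNbhd G v w × InNbhd G u w) ×
    (∀ w' → InNbhd G v w' → InNbhd G u w' → w' ≡ w)

{-# OPTIONS --safe #-}

-- Suppose v and u (same class, so never in a common edge) had two common neighbours w ≢ w',
-- through edges A ∋ v, w;  B ∋ w, u;  C ∋ u, w';  D ∋ w', v.  If A ≡ D and B ≡ C, the distinct
-- edges A, B share w and w', against linearity.  Otherwise the closed walk v A w B u C w' D v
-- contains a loose 3-cycle (when A ≡ D, B ≡ C, A meets C or B meets D) or is a loose 4-cycle,
-- both excluded by the girth.  To exhibit a loose cycle, each edge is listed from one corner to
-- the next; the k-partition provides such listings, through a permutation of the classes.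

module Submission where

open import Data.Bool.Properties using () renaming (_≟_ to _≟ᵇ_)
open import Data.Empty using (⊥; ⊥-elim)
open import Data.Fin using (Fin; zero; suc; toℕ; fromℕ; fromℕ<; inject₁; cast; combine; remQuot)
open import Data.Fin.Patterns using (0F; 1F; 2F; 3F)
open import Data.Fin.Permutation using (Permutation′; transpose; _∘ₚ_; _⟨$⟩ʳ_; _⟨$⟩ˡ_; inverseʳ)
import Data.Fin.Permutation.Components as PC
open import Data.Fin.Properties
  using (_≟_; all?; toℕ-injective; toℕ<n; toℕ-fromℕ; toℕ-fromℕ<; toℕ-inject₁; toℕ-cast; cast-involutive;
         toℕ-combine; remQuot-combine; combine-remQuot; nonZeroIndex; inject₁-injective; fromℕ≢inject₁)
open import Data.Fin.Relation.Unary.Top using (view; ‵fromℕ; ‵inject₁)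
open import Data.Fin.Subset using (Subset; _∈_; _⊂_; ∣_∣; ⁅_⁆)
open import Data.Fin.Subset.Properties using (x∈p∩q⁺; x∈⁅y⁆⇒x≡y; ∣⁅x⁆∣≡1; p⊂q⇒∣p∣<∣q∣)
open import Data.Nat using (ℕ; zero; suc; _+_; _*_; _≤_; _<_; s≤s; NonZero)
open import Data.Nat.DivMod using (_%_; _/_; m%n<n; m≡m%n+[m/n]*n; [m+kn]%n≡m%n; m<n⇒m%n≡m)
open import Data.Nat.Properties using (*-comm; *-suc; +-comm; +-identityʳ; ≤-refl; n≤1+n; <⇒≱)
open import Data.Nat.Tactic.RingSolver using (solve-∀)
open import Data.Product using (Σ; Σ-syntax; ∃-syntax; _×_; _,_; proj₁; proj₂; uncurry)
open import Data.Sum using (_⊎_; inj₁; inj₂)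
open import Data.Vec.Properties using (≡-dec)
open import Function using (_∘_)
open import Function.Bundles using (Injection)
open import Function.Definitions using (Injective)
open import Function.Properties.Inverse using (↔⇒↣)
open import Relation.Binary.Definitions using (DecidableEquality)
open import Relation.Binary.PropositionalEquality
open import Relation.Nullary using (Dec; yes; no)
open import Relation.Nullary.Decidable using (_⊎-dec_; from-yes; decidable-stable; dec-true; dec-false)

open import Defs

next : ∀ {ℓ} → Fin ℓ → Fin ℓ
next {suc ℓ} i = fromℕ< (m%n<n (suc (toℕ i)) (suc ℓ))

next-≡ₘ : ∀ {ℓ} (i : Fin ℓ) → next i ≡ₘ suc (toℕ i)
next-≡ₘ {suc ℓ} i = a / suc ℓ ,
  trans (m≡m%n+[m/n]*n a (suc ℓ)) (cong (_+ a / suc ℓ * suc ℓ) (sym (toℕ-fromℕ< (m%n<n a (suc ℓ)))))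
  where
  a : ℕ
  a = suc (toℕ i)

≡ₘ⇒toℕ≡% : ∀ {N} .{{_ : NonZero N}} {p : Fin N} {a} → p ≡ₘ a → toℕ p ≡ a % N
≡ₘ⇒toℕ≡% {N} {p = p} (q , refl) =
  trans (sym (m<n⇒m%n≡m (toℕ<n p))) (sym ([m+kn]%n≡m%n (toℕ p) q N))

≡ₘ-unique : ∀ {N} {p p' : Fin N} {a} → p ≡ₘ a → p' ≡ₘ a → p ≡ p'
≡ₘ-unique {p = p} p≡a p'≡a = toℕ-injective (trans (≡ₘ⇒toℕ≡% p≡a) (sym (≡ₘ⇒toℕ≡% p'≡a)))
  where
  instance
    nonZero : NonZero _
    nonZero = nonZeroIndex p

module RowMajor (M ℓ : ℕ) where

  pos : Fin ℓ → Fin M → Fin (M * ℓ)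
  pos i j = cast (*-comm ℓ M) (combine i j)

  unpos : Fin (M * ℓ) → Fin ℓ × Fin M
  unpos p = remQuot M (cast (*-comm M ℓ) p)

  toℕ-pos : ∀ i j → toℕ (pos i j) ≡ M * toℕ i + toℕ j
  toℕ-pos i j = trans (toℕ-cast _ (combine i j)) (toℕ-combine i j)

  unpos-pos : ∀ i j → unpos (pos i j) ≡ (i , j)
  unpos-pos i j = trans (cong (remQuot M) (cast-involutive (*-comm M ℓ) (*-comm ℓ M) (combine i j)))
                        (remQuot-combine i j)

  unpos-injective : Injective _≡_ _≡_ unpos
  unpos-injective {p} {p'} eq = begin
    p                      ≡⟨ sym (pos-unpos p) ⟩
    uncurry pos (unpos p)  ≡⟨ cong (uncurry pos) eq ⟩
    uncurry pos (unpos p') ≡⟨ pos-unpos p' ⟩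
    p'                     ∎
    where
    open ≡-Reasoning
    pos-unpos : ∀ p → uncurry pos (unpos p) ≡ p
    pos-unpos p = trans (cong (cast (*-comm ℓ M)) (combine-remQuot {ℓ} M (cast (*-comm M ℓ) p)))
                        (cast-involutive (*-comm ℓ M) (*-comm M ℓ) p)

  pos-≡ₘ : ∀ {i : Fin ℓ} {a} (j : Fin M) → i ≡ₘ a → pos i j ≡ₘ (M * a + toℕ j)
  pos-≡ₘ {i} j (q , refl) = q , (begin
    M * (toℕ i + q * ℓ) + toℕ j       ≡⟨ distribute M (toℕ i) q ℓ (toℕ j) ⟩
    (M * toℕ i + toℕ j) + q * (M * ℓ) ≡⟨ cong (_+ q * (M * ℓ)) (sym (toℕ-pos i j)) ⟩
    toℕ (pos i j) + q * (M * ℓ)       ∎)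
    where
    open ≡-Reasoning
    distribute : ∀ M a q ℓ b → M * (a + q * ℓ) + b ≡ (M * a + b) + q * (M * ℓ)
    distribute = solve-∀

record EdgeTraversal (G : Hypergraph) (m : ℕ) (e : Subset (n G)) (x y : Fin (n G)) : Set where
  field
    vertex    : Fin (suc m) → Fin (n G)
    injective : Injective _≡_ _≡_ vertex
    vertex-∈  : ∀ j → vertex j ∈ e
    onto      : ∀ {z} → z ∈ e → ∃[ j ] vertex j ≡ z
    first     : vertex zero ≡ x
    last      : vertex (fromℕ m) ≡ y

module _ {G : Hypergraph} {m ℓ : ℕ}
  (edge : Fin ℓ → Subset (n G)) (corner : Fin ℓ → Fin (n G)) (isEdge : ∀ i → E G (edge i))
  (traversal : ∀ i → EdgeTraversal G (suc m) (edge i) (corner i) (corner (next i)))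
  (separated : ∀ {i i' x} → x ∈ edge i → x ∈ edge i' →
               x ≢ corner (next i) → x ≢ corner (next i') → i ≡ i')
  where

  private
    open ≡-Reasoning
    M : ℕ
    M = suc m
    open RowMajor M ℓ
    module T (i : Fin ℓ) = EdgeTraversal (traversal i)

    inner : Fin ℓ × Fin M → Fin (n G)
    inner (i , j) = T.vertex i (inject₁ j)

    inner-≢-corner : ∀ i j → inner (i , j) ≢ corner (next i)
    inner-≢-corner i j eq = fromℕ≢inject₁ (T.injective i (trans (T.last i) (sym eq)))

    inner-injective : Injective _≡_ _≡_ inner
    inner-injective {i , j} {i' , j'} eq
      with separated (T.vertex-∈ i _) (subst (_∈ edge i') (sym eq) (T.vertex-∈ i' _))
                     (inner-≢-corner i j) (subst (_≢ corner (next i')) (sym eq) (inner-≢-corner i' j'))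
    ... | refl = cong (i ,_) (inject₁-injective (T.injective i eq))

    cycleVertex : Fin (M * ℓ) → Fin (n G)
    cycleVertex = inner ∘ unpos

    -- Slot j of edge i sits at position M·i + j; the last slot is the first of edge (next i).
    occurrence : ∀ i j → ∃[ p ] p ≡ₘ (M * toℕ i + toℕ j) × cycleVertex p ≡ T.vertex i j
    occurrence i j with view j
    ... | ‵inject₁ r = pos i r , (0 , at-r) , cong inner (unpos-pos i r)
      where
      at-r : M * toℕ i + toℕ (inject₁ r) ≡ toℕ (pos i r) + 0
      at-r = begin
        M * toℕ i + toℕ (inject₁ r) ≡⟨ cong (M * toℕ i +_) (toℕ-inject₁ r) ⟩
        M * toℕ i + toℕ r           ≡⟨ toℕ-pos i r ⟨
        toℕ (pos i r)               ≡⟨ +-identityʳ _ ⟨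
        toℕ (pos i r) + 0           ∎
    ... | ‵fromℕ = pos (next i) zero , subst (pos (next i) zero ≡ₘ_) at-end (pos-≡ₘ zero (next-≡ₘ i)) ,
      trans (cong inner (unpos-pos (next i) zero)) (trans (T.first (next i)) (sym (T.last i)))
      where
      at-end : M * suc (toℕ i) + 0 ≡ M * toℕ i + toℕ (fromℕ M)
      at-end = begin
        M * suc (toℕ i) + 0       ≡⟨ +-identityʳ _ ⟩
        M * suc (toℕ i)           ≡⟨ *-suc M (toℕ i) ⟩
        M + M * toℕ i             ≡⟨ +-comm M _ ⟩
        M * toℕ i + M             ≡⟨ cong (M * toℕ i +_) (toℕ-fromℕ M) ⟨
        M * toℕ i + toℕ (fromℕ M) ∎

    OnCycleEdge : Fin ℓ → Fin (n G) → Set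
    OnCycleEdge i x = Σ[ j ∈ Fin (suc M) ] ∃[ p ] p ≡ₘ (M * toℕ i + toℕ j) × cycleVertex p ≡ x

    edge⇒onCycleEdge : ∀ i {x} → x ∈ edge i → OnCycleEdge i x
    edge⇒onCycleEdge i x∈ with T.onto i x∈
    ... | j , refl = j , occurrence i j

    onCycleEdge⇒edge : ∀ i {x} → OnCycleEdge i x → x ∈ edge i
    onCycleEdge⇒edge i (j , p , p≡ₘ , refl) with occurrence i j
    ... | p' , p'≡ₘ , at-p' =
      subst (_∈ edge i) (trans (sym at-p') (cong cycleVertex (≡ₘ-unique p'≡ₘ p≡ₘ))) (T.vertex-∈ i j)

  looseCycle-fromTraversals : LooseCycle (suc (suc m)) ℓ G
  looseCycle-fromTraversals =
    cycleVertex , (λ eq → unpos-injective (inner-injective eq)) ,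
    λ i → edge i , isEdge i , λ x → edge⇒onCycleEdge i , onCycleEdge⇒edge i

transpose-matchˡ : ∀ {k} (i j : Fin k) → PC.transpose i j i ≡ j
transpose-matchˡ i j rewrite dec-true (i ≟ i) refl = refl

transpose-other : ∀ {k} {i j l : Fin k} → l ≢ i → l ≢ j → PC.transpose i j l ≡ l
transpose-other {i = i} {j} {l} l≢i l≢j rewrite dec-false (l ≟ i) l≢i | dec-false (l ≟ j) l≢j = refl

-- π = (0 a) ∘ (last c), where c is the preimage of b under (0 a); c ≢ 0 because a ≢ b.
permutation-withEnds : ∀ {m} {a b : Fin (suc (suc m))} → a ≢ b →
  Σ (Permutation′ (suc (suc m))) λ π → π ⟨$⟩ʳ zero ≡ a × π ⟨$⟩ʳ fromℕ (suc m) ≡ b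
permutation-withEnds {m} {a} {b} a≢b = transpose last c ∘ₚ transpose zero a , zero↦a , last↦b
  where
  open ≡-Reasoning
  last c : Fin (suc (suc m))
  last = fromℕ (suc m)
  c = PC.transpose a zero b

  zero≢c : zero ≢ c
  zero≢c zero≡c = a≢b (begin
    a                        ≡⟨ transpose-matchˡ zero a ⟨
    PC.transpose zero a zero ≡⟨ cong (PC.transpose zero a) zero≡c ⟩
    PC.transpose zero a c    ≡⟨ PC.transpose-inverse zero a ⟩
    b                        ∎)

  zero↦a : PC.transpose zero a (PC.transpose last c zero) ≡ a
  zero↦a = begin
    PC.transpose zero a (PC.transpose last c zero)
      ≡⟨ cong (PC.transpose zero a) (transpose-other {i = last} (λ ()) zero≢c) ⟩
    PC.transpose zero a zero                       ≡⟨ transpose-matchˡ zero a ⟩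
    a                                              ∎

  last↦b : PC.transpose zero a (PC.transpose last c last) ≡ b
  last↦b = begin
    PC.transpose zero a (PC.transpose last c last) ≡⟨ cong (PC.transpose zero a) (transpose-matchˡ last c) ⟩
    PC.transpose zero a c                          ≡⟨ PC.transpose-inverse zero a ⟩
    b                                              ∎

module Partite {G : Hypergraph} {k : ℕ} {part : Fin (n G) → Fin k} (partition : IsKPartition k G part) where

  classVertex : ∀ {e} → E G e → Fin k → Fin (n G)
  classVertex h c = proj₁ (partition _ h c)

  classVertex-∈ : ∀ {e} (h : E G e) c → classVertex h c ∈ e
  classVertex-∈ h c = proj₁ (proj₁ (proj₂ (partition _ h c)))

  part-classVertex : ∀ {e} (h : E G e) c → part (classVertex h c) ≡ c
  part-classVertex h c = proj₂ (proj₁ (proj₂ (partition _ h c)))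

  classVertex-part : ∀ {e x} (h : E G e) → x ∈ e → classVertex h (part x) ≡ x
  classVertex-part h x∈ = sym (proj₂ (proj₂ (partition _ h _)) _ x∈ refl)

  classVertex-injective : ∀ {e} (h : E G e) → Injective _≡_ _≡_ (classVertex h)
  classVertex-injective h eq = trans (sym (part-classVertex h _)) (trans (cong part eq) (part-classVertex h _))

  classmates-equal : ∀ {e x y} → E G e → x ∈ e → y ∈ e → part x ≡ part y → x ≡ y
  classmates-equal h x∈ y∈ eq = begin
    _                      ≡⟨ classVertex-part h x∈ ⟨
    classVertex h (part _) ≡⟨ cong (classVertex h) eq ⟩
    classVertex h (part _) ≡⟨ classVertex-part h y∈ ⟩
    _                      ∎
    where open ≡-Reasoning

edgeTraversal : ∀ {G m part} → IsKPartition (suc (suc m)) G part →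
  ∀ {e x y} → E G e → x ∈ e → y ∈ e → x ≢ y → EdgeTraversal G (suc m) e x y
edgeTraversal {m = m} {part} partition {x = x} {y} h x∈ y∈ x≢y = record
  { vertex    = classVertex h ∘ (π ⟨$⟩ʳ_)
  ; injective = Injection.injective (↔⇒↣ π) ∘ classVertex-injective h
  ; vertex-∈  = classVertex-∈ h ∘ (π ⟨$⟩ʳ_)
  ; onto      = λ z∈ → π ⟨$⟩ˡ part _ , trans (cong (classVertex h) (inverseʳ π)) (classVertex-part h z∈)
  ; first     = trans (cong (classVertex h) π-first) (classVertex-part h x∈)
  ; last      = trans (cong (classVertex h) π-last) (classVertex-part h y∈)
  }
  where
  open Partite partition
  ends : Σ (Permutation′ (suc (suc m))) λ π →
           π ⟨$⟩ʳ zero ≡ part x × π ⟨$⟩ʳ fromℕ (suc m) ≡ part y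
  ends = permutation-withEnds (x≢y ∘ classmates-equal h x∈ y∈)
  π : Permutation′ (suc (suc m))
  π = proj₁ ends
  π-first : π ⟨$⟩ʳ zero ≡ part x
  π-first = proj₁ (proj₂ ends)
  π-last : π ⟨$⟩ʳ fromℕ (suc m) ≡ part y
  π-last = proj₂ (proj₂ ends)

distinct-∈⇒1<∣∣ : ∀ {N} {p : Subset N} {x y} → x ∈ p → y ∈ p → x ≢ y → 1 < ∣ p ∣
distinct-∈⇒1<∣∣ {p = p} {x} x∈p y∈p x≢y = subst (_< ∣ p ∣) (∣⁅x⁆∣≡1 x) (p⊂q⇒∣p∣<∣q∣ ⁅x⁆⊂p)
  where
  ⁅x⁆⊂p : ⁅ x ⁆ ⊂ p
  ⁅x⁆⊂p = (λ z∈⁅x⁆ → subst (_∈ p) (sym (x∈⁅y⁆⇒x≡y x z∈⁅x⁆)) x∈p) ,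
          _ , y∈p , x≢y ∘ sym ∘ x∈⁅y⁆⇒x≡y x

linear-meet : ∀ {G} → IsLinear G → ∀ {e f x y} → E G e → E G f → e ≢ f →
              x ∈ e → x ∈ f → y ∈ e → y ∈ f → x ≡ y
linear-meet linear he hf e≢f x∈e x∈f y∈e y∈f = decidable-stable (_ ≟ _) λ x≢y →
  <⇒≱ (distinct-∈⇒1<∣∣ (x∈p∩q⁺ (x∈e , x∈f)) (x∈p∩q⁺ (y∈e , y∈f)) x≢y) (linear _ _ he hf e≢f)

EqualOrConsecutive : ∀ {ℓ} → Fin ℓ → Fin ℓ → Set
EqualOrConsecutive i i' = i ≡ i' ⊎ i' ≡ next i ⊎ i ≡ next i'

equalOrConsecutive? : ∀ {ℓ} (i i' : Fin ℓ) → Dec (EqualOrConsecutive i i')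
equalOrConsecutive? i i' = i ≟ i' ⊎-dec i' ≟ next i ⊎-dec i ≟ next i'

all-equalOrConsecutive₃ : ∀ (i i' : Fin 3) → EqualOrConsecutive i i'
all-equalOrConsecutive₃ = from-yes (all? λ (i : Fin 3) → all? λ (i' : Fin 3) → equalOrConsecutive? i i')

equalOrConsecutive-or-opposite₄ : ∀ (i i' : Fin 4) → EqualOrConsecutive i i' ⊎ i' ≡ next (next i)
equalOrConsecutive-or-opposite₄ =
  from-yes (all? λ (i : Fin 4) → all? λ (i' : Fin 4) → equalOrConsecutive? i i' ⊎-dec i' ≟ next (next i))

record ClosedTrail (G : Hypergraph) (ℓ : ℕ) : Set where
  field
    edge          : Fin ℓ → Subset (n G)
    corner        : Fin ℓ → Fin (n G)
    isEdge        : ∀ i → E G (edge i)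
    corner-∈      : ∀ i → corner i ∈ edge i
    next-corner-∈ : ∀ i → corner (next i) ∈ edge i
    corner≢next   : ∀ i → corner i ≢ corner (next i)
    edge≢next     : ∀ i → edge i ≢ edge (next i)

  OnlyConsecutiveEdgesMeet : Set
  OnlyConsecutiveEdgesMeet = ∀ {i i' x} → x ∈ edge i → x ∈ edge i' → EqualOrConsecutive i i'

module LinearPartite {G : Hypergraph} {m : ℕ} {part : Fin (n G) → Fin (suc (suc m))}
  (partition : IsKPartition (suc (suc m)) G part) (linear : IsLinear G) where

  looseCycle : ∀ {ℓ} (T : ClosedTrail G ℓ) → ClosedTrail.OnlyConsecutiveEdgesMeet T →
               LooseCycle (suc (suc m)) ℓ G
  looseCycle T meet = looseCycle-fromTraversals edge corner isEdge
    (λ i → edgeTraversal partition (isEdge i) (corner-∈ i) (next-corner-∈ i) (corner≢next i))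
    separated
    where
    open ClosedTrail T
    meet-next : ∀ {i x} → x ∈ edge i → x ∈ edge (next i) → x ≡ corner (next i)
    meet-next {i} x∈ x∈next =
      linear-meet linear (isEdge i) (isEdge (next i)) (edge≢next i)
                  x∈ x∈next (next-corner-∈ i) (corner-∈ (next i))
    separated : ∀ {i i' x} → x ∈ edge i → x ∈ edge i' →
                x ≢ corner (next i) → x ≢ corner (next i') → i ≡ i'
    separated x∈ x∈' x≢ x≢' with meet x∈ x∈'
    ... | inj₁ i≡i'        = i≡i'
    ... | inj₂ (inj₁ refl) = ⊥-elim (x≢ (meet-next x∈ x∈'))
    ... | inj₂ (inj₂ refl) = ⊥-elim (x≢' (meet-next x∈' x∈))

  triangle-looseCycle : ClosedTrail G 3 → LooseCycle (suc (suc m)) 3 G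
  triangle-looseCycle T = looseCycle T λ {i} {i'} _ _ → all-equalOrConsecutive₃ i i'

  square-looseCycle : (T : ClosedTrail G 4) → let open ClosedTrail T in
                      (∀ {x} → x ∈ edge 0F → x ∈ edge 2F → ⊥) →
                      (∀ {x} → x ∈ edge 1F → x ∈ edge 3F → ⊥) →
                      LooseCycle (suc (suc m)) 4 G
  square-looseCycle T edge₀∩edge₂≡∅ edge₁∩edge₃≡∅ = looseCycle T meet
    where
    open ClosedTrail T
    opposite-disjoint : ∀ i {x} → x ∈ edge i → x ∈ edge (next (next i)) → ⊥
    opposite-disjoint 0F x∈₀ x∈₂ = edge₀∩edge₂≡∅ x∈₀ x∈₂
    opposite-disjoint 1F x∈₁ x∈₃ = edge₁∩edge₃≡∅ x∈₁ x∈₃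
    opposite-disjoint 2F x∈₂ x∈₀ = edge₀∩edge₂≡∅ x∈₀ x∈₂
    opposite-disjoint 3F x∈₃ x∈₁ = edge₁∩edge₃≡∅ x∈₁ x∈₃
    meet : OnlyConsecutiveEdgesMeet
    meet {i} {i'} x∈ x∈' with equalOrConsecutive-or-opposite₄ i i'
    ... | inj₁ consecutive = consecutive
    ... | inj₂ refl        = ⊥-elim (opposite-disjoint i x∈ x∈')

_≟ₛ_ : ∀ {N} → DecidableEquality (Subset N)
_≟ₛ_ = ≡-dec _≟ᵇ_

module CommonNeighbours {G : Hypergraph} {m : ℕ} {part : Fin (n G) → Fin (suc (suc m))}
  (partition : IsKPartition (suc (suc m)) G part) (linear : IsLinear G)
  (girth : GirthAtLeast (suc (suc m)) 5 G) where

  open Partite partition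
  open LinearPartite partition linear

  classmates-separate : ∀ {v u e f} → part v ≡ part u → v ≢ u → E G e → v ∈ e → u ∈ f → e ≢ f
  classmates-separate pvu v≢u he v∈e u∈f e≡f =
    v≢u (classmates-equal he v∈e (subst (_ ∈_) (sym e≡f) u∈f) pvu)

  opposite-edges-disjoint : ∀ {v u w A B C} → part v ≡ part u → v ≢ u → w ≢ u →
    E G A → E G B → E G C → v ∈ A → w ∈ A → w ∈ B → u ∈ B → u ∈ C → B ≢ C →
    ∀ {z} → z ∈ A → z ∈ C → ⊥
  opposite-edges-disjoint {v} {u} {w} {A} {B} {C} pvu v≢u w≢u hA hB hC vA wA wB uB uC B≢C {z} zA zC =
    girth 3 ≤-refl (n≤1+n 4) (triangle-looseCycle trail)
    where
    z≢w : z ≢ w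
    z≢w z≡w = w≢u (linear-meet linear hB hC B≢C wB (subst (_∈ C) z≡w zC) uB uC)
    u≢z : u ≢ z
    u≢z u≡z = classmates-separate pvu v≢u hA vA (subst (_∈ A) (sym u≡z) zA) refl
    A≢B : A ≢ B
    A≢B = classmates-separate pvu v≢u hA vA uB
    C≢A : C ≢ A
    C≢A = classmates-separate pvu v≢u hA vA uC ∘ sym
    trail : ClosedTrail G 3
    trail = record
      { edge          = λ { 0F → A   ; 1F → B   ; 2F → C   }
      ; corner        = λ { 0F → z   ; 1F → w   ; 2F → u   }
      ; isEdge        = λ { 0F → hA  ; 1F → hB  ; 2F → hC  }
      ; corner-∈      = λ { 0F → zA  ; 1F → wB  ; 2F → uC  }
      ; next-corner-∈ = λ { 0F → wA  ; 1F → uB  ; 2F → zC  }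
      ; corner≢next   = λ { 0F → z≢w ; 1F → w≢u ; 2F → u≢z }
      ; edge≢next     = λ { 0F → A≢B ; 1F → B≢C ; 2F → C≢A }
      }

  common-neighbour-unique : ∀ {v u w w'} → part v ≡ part u → v ≢ u →
    InNbhd G v w → InNbhd G u w → InNbhd G v w' → InNbhd G u w' → w' ≡ w
  common-neighbour-unique {v} {u} {w} {w'} pvu v≢u (w≢v , A , hA , vA , wA) (w≢u , B , hB , uB , wB)
                          (w'≢v , D , hD , vD , w'D) (w'≢u , C , hC , uC , w'C) =
    decidable-stable (w' ≟ w) λ w'≢w → closed-walk w'≢w (A ≟ₛ D) (B ≟ₛ C)
    where
    A≢B : A ≢ B
    A≢B = classmates-separate pvu v≢u hA vA uB
    D≢C : D ≢ C
    D≢C = classmates-separate pvu v≢u hD vD uC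
    A∩C-empty : B ≢ C → ∀ {z} → z ∈ A → z ∈ C → ⊥
    A∩C-empty = opposite-edges-disjoint pvu v≢u w≢u hA hB hC vA wA wB uB uC
    B∩D-empty : A ≢ D → ∀ {z} → z ∈ B → z ∈ D → ⊥
    B∩D-empty A≢D = opposite-edges-disjoint (sym pvu) (v≢u ∘ sym) w≢v hB hA hD uB wB wA vA vD A≢D
    square : A ≢ D → B ≢ C → ClosedTrail G 4
    square A≢D B≢C = record
      { edge          = λ { 0F → A           ; 1F → B   ; 2F → C            ; 3F → D           }
      ; corner        = λ { 0F → v           ; 1F → w   ; 2F → u            ; 3F → w'          }
      ; isEdge        = λ { 0F → hA          ; 1F → hB  ; 2F → hC           ; 3F → hD          }
      ; corner-∈      = λ { 0F → vA          ; 1F → wB  ; 2F → uC           ; 3F → w'D         }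
      ; next-corner-∈ = λ { 0F → wA          ; 1F → uB  ; 2F → w'C          ; 3F → vD          }
      ; corner≢next   = λ { 0F → w≢v ∘ sym   ; 1F → w≢u ; 2F → w'≢u ∘ sym   ; 3F → w'≢v        }
      ; edge≢next     = λ { 0F → A≢B         ; 1F → B≢C ; 2F → D≢C ∘ sym    ; 3F → A≢D ∘ sym   }
      }
    closed-walk : w' ≢ w → Dec (A ≡ D) → Dec (B ≡ C) → ⊥
    closed-walk w'≢w (yes A≡D) (yes B≡C) =
      w'≢w (linear-meet linear hA hB A≢B (subst (w' ∈_) (sym A≡D) w'D) (subst (w' ∈_) (sym B≡C) w'C)
                                         wA wB)
    closed-walk _ (yes A≡D) (no B≢C) = A∩C-empty B≢C (subst (w' ∈_) (sym A≡D) w'D) w'C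
    closed-walk _ (no A≢D) (yes B≡C) = B∩D-empty A≢D (subst (w' ∈_) (sym B≡C) w'C) w'D
    closed-walk _ (no A≢D) (no B≢C) =
      girth 4 (n≤1+n 3) ≤-refl (square-looseCycle (square A≢D B≢C) (A∩C-empty B≢C) (B∩D-empty A≢D))

lemma2p2 : (k : ℕ) → 3 ≤ k → (G : Hypergraph) → IsKGraph k G →
           (part : Fin (n G) → Fin k) → IsKPartition k G part →
           IsLinear G → GirthAtLeast k 5 G →
           ∀ (c : Fin k) (v u : Fin (n G)) → Z₂Edge G part c v u →
           CommonNbhdSizeOne G v u
lemma2p2 _ (s≤s (s≤s _)) G _ part partition linear girth c v u (v∈c , u∈c , v≢u , w , v~w , u~w) =
  w , (v~w , u~w) , λ w' v~w' u~w' → common-neighbour-unique (trans v∈c (sym u∈c)) v≢u v~w u~w v~w' u~w'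
  where open CommonNeighbours partition linear girth
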